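{- The program transformation (probassoc) of $L_{need,\oplus}$, which relates $r\oplus(s\oplus t)$ to $(r\oplus s)\oplus t$ for all expressions $r,s,t$, is not correct, i.e. there are $r,s,t$ with $r\oplus(s\oplus t)\not\sim_c (r\oplus s)\oplus t$.
   Context: Expressions of $L_{need,\oplus}$: $s,t,r ::= x \mid \lambda x.s \mid (s\,t) \mid (s\oplus t) \mid \mathtt{let}\ env\ \mathtt{in}\ s$, with $env$ a (possibly empty) multiset of bindings $x_1=s_1,\dots,x_n=s_n$ with pairwise distinct $x_i$ and recursive scope; up to $\alpha$-equivalence. $\{x_i=s_{f(i)}\}_{i=j}^m$ abbreviates $x_j=s_{f(j)},\dots,x_m=s_{f(m)}$. A context has one hole anywhere. $A ::= [\cdot]\mid (A\ s)$; reduction contexts $R ::= A \mid \mathtt{let}\ env\ \mathtt{in}\ A \mid \mathtt{let}\ env, \{x_i=A_i[x_{i+1}]\}_{i=1}^n, x_{n+1}=A_{n+1}\ \mathtt{in}\ A[x_1]$. Standard reduction: (lbeta) $R[((\lambda x.s)\ t)] \to R[\mathtt{let}\ x=t\ \mathtt{in}\ s]$; (probl) $R[s\oplus t]\to R[s]$; (probr) $R[s\oplus t]\to R[t]$; (lapp) $R[((\mathtt{let}\ env\ \mathtt{in}\ s)\ t)] \to R[\mathtt{let}\ env\ \mathtt{in}\ (s\ t)]$; (llet-in) $\mathtt{let}\ env_1\ \mathtt{in}\ (\mathtt{let}\ env_2\ \mathtt{in}\ s) \to \mathtt{let}\ env_1,env_2\ \mathtt{in}\ s$; (llet-e) $\mathtt{let}\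 \{x_i=A_i[x_{i+1}]\}_{i=1}^{n-1}, x_n=(\mathtt{let}\ env_1\ \mathtt{in}\ s), env_2\ \mathtt{in}\ A[x_1] \to \mathtt{let}\ \{x_i=A_i[x_{i+1}]\}_{i=1}^{n-1}, x_n=s, env_1, env_2\ \mathtt{in}\ A[x_1]$; (cp-in) $\mathtt{let}\ \{x_i=x_{i+1}\}_{i=1}^{n-1}, x_n=\lambda y.s, env\ \mathtt{in}\ A[x_1] \to \mathtt{let}\ \{x_i=x_{i+1}\}_{i=1}^{n-1}, x_n=\lambda y.s, env\ \mathtt{in}\ A[\lambda y.s]$; (cp-e) $\mathtt{let}\ \{x_i=A_i[x_{i+1}]\}_{i=1}^{n-1}, x_n=A_n[y_1], \{y_j=y_{j+1}\}_{j=1}^{m-1}, y_m=\lambda z.s, env\ \mathtt{in}\ A[x_1] \to$ the same with $x_n=A_n[\lambda z.s]$, where $A_n\ne[\cdot]$, $n,m\ge1$. A WHNF is an abstraction or $\mathtt{let}\ env\ \mathtt{in}\ \lambda x.s$; an evaluation is a finite standard reduction sequence ending in a WHNF; its prob-length is its number of (probl)/(probr) steps. $\mathit{ExCv}(s)=\sum 2^{ -m}$ over all evaluations of $s$ with prob-length $m$. $s\le_c t$ iff $\mathit{ExCv}(C[s])\le\mathit{ExCv}(C[t])$ for all contexts $C$; $s\sim_c t$ iff both directions hold. A transformation (binary relation on expressions) is correct iff it is contained in $\sim_c$. -}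

module Defs where

open import Data.Nat using (ℕ; zero; suc; _+_)
open import Data.Fin using (Fin; _↑ˡ_; _↑ʳ_; splitAt)
open import Data.Vec using (Vec; []; _∷_; lookup; _++_; _[_]≔_)
open import Data.List using (List; []; _∷_; foldl; foldr)
open import Data.List.Relation.Unary.All using (All)
open import Data.List.Relation.Unary.Unique.Propositional using (Unique)
open import Data.Sum using (_⊎_; inj₁; inj₂; [_,_]′)
open import Data.Product using (Σ; _×_; _,_; ∃)
open import Data.Rational using (ℚ; 0ℚ; 1ℚ; ½; _*_; _≤_; _<_) renaming (_+_ to _+ℚ_)
open import Relation.Binary.PropositionalEquality using (_≡_)
open import Function using (_∘_)

-- Expressions of L_need,⊕ in de Bruijn form (α-equivalence is built in).  A letrec
--   lett k env s  binds k variables (indices 0..k-1 of scope k + n,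
--   i.e. binding i is the variable  i ↑ˡ n) recursively in env and s.
-- The multiset env is represented by a vector; k = 0 is the empty env.

data Tm (n : ℕ) : Set where
  var  : Fin n → Tm n
  lam  : Tm (suc n) → Tm n
  app  : Tm n → Tm n → Tm n
  _⊕_  : Tm n → Tm n → Tm n
  lett : (k : ℕ) → Vec (Tm (k + n)) k → Tm (k + n) → Tm n

infixl 5 _⊕_

liftR : ∀ {n m} (k : ℕ) → (Fin n → Fin m) → Fin (k + n) → Fin (k + m)
liftR {n} {m} k ρ i = [ (λ j → j ↑ˡ m) , (λ j → k ↑ʳ ρ j) ]′ (splitAt k i)

mutual
  rename : ∀ {n m} → (Fin n → Fin m) → Tm n → Tm m
  rename ρ (var i)        = var (ρ i)
  rename ρ (lam s)        = lam (rename (liftR 1 ρ) s)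
  rename ρ (app s t)      = app (rename ρ s) (rename ρ t)
  rename ρ (s ⊕ t)        = rename ρ s ⊕ rename ρ t
  rename ρ (lett k env s) = lett k (renameV (liftR k ρ) env) (rename (liftR k ρ) s)

  renameV : ∀ {n m k} → (Fin n → Fin m) → Vec (Tm n) k → Vec (Tm m) k
  renameV ρ []       = []
  renameV ρ (s ∷ ss) = rename ρ s ∷ renameV ρ ss

wkN : ∀ {n} (k : ℕ) → Tm n → Tm (k + n)
wkN k = rename (k ↑ʳ_)

-- merging two nested lets  let env1 (k1) in (let env2 (k2) in ...)
-- into one let with bindings env1, env2 (k1 + k2 bindings)
mergeOuter : ∀ {n} k1 k2 → Fin (k1 + n) → Fin ((k1 + k2) + n)
mergeOuter {n} k1 k2 i =
  [ (λ j → (j ↑ˡ k2) ↑ˡ n) , (λ v → (k1 + k2) ↑ʳ v) ]′ (splitAt k1 i)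

mergeInner : ∀ {n} k1 k2 → Fin (k2 + (k1 + n)) → Fin ((k1 + k2) + n)
mergeInner {n} k1 k2 i =
  [ (λ j → (k1 ↑ʳ j) ↑ˡ n) , mergeOuter k1 k2 ]′ (splitAt k2 i)

-- A-contexts  A ::= [·] | (A s) , represented by the list of arguments:
-- plugA t (s1 ∷ … ∷ sk ∷ []) = (…((t s1) s2) … sk)

plugA : ∀ {n} → Tm n → List (Tm n) → Tm n
plugA t as = foldl app t as

bindOf : ∀ {k n} → Vec (Tm (k + n)) k → Fin k → Tm (k + n)
bindOf env i = lookup env i

-- Chain env x y : bindings  x = A_1[x_2], …, x_{j} = A_{j}[y]  in env
-- (possibly of length 0, i.e. x = y)
data Chain {k n : ℕ} (env : Vec (Tm (k + n)) k) : Fin k → Fin k → Set where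
  here  : ∀ {x} → Chain env x x
  there : ∀ {x z y} (as : List (Tm (k + n))) →
          bindOf env x ≡ plugA (var (z ↑ˡ n)) as → Chain env z y → Chain env x y

-- VarChain env x y : bindings  x = x_2, …, x_j = y  (plain variable chain)
data VarChain {k n : ℕ} (env : Vec (Tm (k + n)) k) : Fin k → Fin k → Set where
  here  : ∀ {x} → VarChain env x x
  there : ∀ {x z y} →
          bindOf env x ≡ var (z ↑ˡ n) → VarChain env z y → VarChain env x y

data Rule : Set where
  lbeta probl probr lapp llet-in llet-e cp-in cp-e : Rule

data Loc {m : ℕ} : Rule → Tm m → Tm m → Set where
  lbeta : ∀ (s : Tm (suc m)) t → Loc lbeta (app (lam s) t) (lett 1 (wkN 1 t ∷ []) s)
  probl : ∀ s t → Loc probl (s ⊕ t) s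
  probr : ∀ s t → Loc probr (s ⊕ t) t
  lapp  : ∀ k env s t → Loc lapp (app (lett k env s) t) (lett k env (app s (wkN k t)))

-- closure under reduction contexts
--  R ::= A | let env in A | let env, {x_i = A_i[x_{i+1}]}_{i=1}^n, x_{n+1} = A_{n+1} in A[x_1]
data RStep {n : ℕ} (r : Rule) : Tm n → Tm n → Set where
  inA     : ∀ {a b} (as : List (Tm n)) → Loc r a b → RStep r (plugA a as) (plugA b as)
  inBody  : ∀ k env {a b} (as : List (Tm (k + n))) → Loc r a b →
            RStep r (lett k env (plugA a as)) (lett k env (plugA b as))
  inChain : ∀ k env {a b} (as : List (Tm (k + n))) (x y : Fin k)
            (as' : List (Tm (k + n))) →
            Chain env x y → bindOf env y ≡ plugA a as' → Loc r a b →
            RStep r (lett k env (plugA (var (x ↑ˡ n)) as))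
                    (lett k (env [ y ]≔ plugA b as') (plugA (var (x ↑ˡ n)) as))

data Step {n : ℕ} : Rule → Tm n → Tm n → Set where
  rstep   : ∀ {r s t} → RStep r s t → Step r s t
  llet-in : ∀ k1 (env1 : Vec (Tm (k1 + n)) k1) k2 (env2 : Vec (Tm (k2 + (k1 + n))) k2) s →
            Step llet-in (lett k1 env1 (lett k2 env2 s))
                         (lett (k1 + k2) (renameV (mergeOuter k1 k2) env1 ++ renameV (mergeInner k1 k2) env2)
                               (rename (mergeInner k1 k2) s))
  llet-e  : ∀ k env (as : List (Tm (k + n))) (x y : Fin k) k1
              (env1 : Vec (Tm (k1 + (k + n))) k1) (s : Tm (k1 + (k + n))) →
            Chain env x y → bindOf env y ≡ lett k1 env1 s →
            Step llet-e (lett k env (plugA (var (x ↑ˡ n)) as))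
                        (lett (k + k1)
                              ((renameV (mergeOuter k k1) env ++ renameV (mergeInner k k1) env1)
                                 [ y ↑ˡ k1 ]≔ rename (mergeInner k k1) s)
                              (rename (mergeOuter k k1) (plugA (var (x ↑ˡ n)) as)))
  cp-in   : ∀ k env (as : List (Tm (k + n))) (x y : Fin k) (u : Tm (suc (k + n))) →
            VarChain env x y → bindOf env y ≡ lam u →
            Step cp-in (lett k env (plugA (var (x ↑ˡ n)) as))
                       (lett k env (plugA (lam u) as))
  cp-e    : ∀ k env (as : List (Tm (k + n))) (x z y w : Fin k)
              (c : Tm (k + n)) (cs : List (Tm (k + n))) (u : Tm (suc (k + n))) →
            Chain env x z → bindOf env z ≡ plugA (var (y ↑ˡ n)) (c ∷ cs) →
            VarChain env y w → bindOf env w ≡ lam u →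
            Step cp-e (lett k env (plugA (var (x ↑ˡ n)) as))
                      (lett k (env [ z ]≔ plugA (lam u) (c ∷ cs)) (plugA (var (x ↑ˡ n)) as))

data WHNF {n : ℕ} : Tm n → Set where
  lamW : ∀ s → WHNF (lam s)
  letW : ∀ k env s → WHNF (lett k env (lam s))

-- An evaluation of s is recorded by its trace: the list of
-- (rule, resulting expression) of its steps.

Trace : ℕ → Set
Trace n = List (Rule × Tm n)

data IsEval {n : ℕ} : Tm n → Trace n → Set where
  done : ∀ {s} → WHNF s → IsEval s []
  step : ∀ {r s t τ} → Step r s t → IsEval t τ → IsEval s ((r , t) ∷ τ)

isProb : Rule → ℕ
isProb probl = 1
isProb probr = 1
isProb _     = 0

probLength : ∀ {n} → Trace n → ℕ
probLength []             = 0
probLength ((r , _) ∷ τ)  = isProb r + probLength τ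

halfPow : ℕ → ℚ
halfPow zero    = 1ℚ
halfPow (suc m) = ½ * halfPow m

sumW : ∀ {n} → List (Trace n) → ℚ
sumW = foldr (λ τ acc → halfPow (probLength τ) +ℚ acc) 0ℚ

-- ExCv(s) ≤ ExCv(t), where ExCv(u) = Σ_{evaluations} 2^{-m} is the sum of a
-- family of non-negative rationals, i.e. the supremum of its finite partial
-- sums over sets of pairwise distinct evaluations.
ExCv≤ : ∀ {n} → Tm n → Tm n → Set
ExCv≤ s t = ∀ (F : List (Trace _)) → Unique F → All (IsEval s) F →
            ∀ (ε : ℚ) → 0ℚ < ε →
            Σ (List (Trace _)) λ G → Unique G × All (IsEval t) G × (sumW F ≤ sumW G +ℚ ε)

-- General contexts (one hole, anywhere).  Ctx n m : outer scope n, hole scope m.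

data Ctx (n : ℕ) : ℕ → Set where
  hole    : Ctx n n
  lamC    : ∀ {m} → Ctx (suc n) m → Ctx n m
  appL    : ∀ {m} → Ctx n m → Tm n → Ctx n m
  appR    : ∀ {m} → Tm n → Ctx n m → Ctx n m
  orL     : ∀ {m} → Ctx n m → Tm n → Ctx n m
  orR     : ∀ {m} → Tm n → Ctx n m → Ctx n m
  letBody : ∀ {m} k → Vec (Tm (k + n)) k → Ctx (k + n) m → Ctx n m
  -- hole in binding i (the i-th entry of env is overwritten)
  letBind : ∀ {m} k → Vec (Tm (k + n)) k → Fin k → Ctx (k + n) m → Tm (k + n) → Ctx n m

plug : ∀ {n m} → Ctx n m → Tm m → Tm n
plug hole             s = s
plug (lamC C)         s = lam (plug C s)
plug (appL C t)       s = app (plug C s) t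
plug (appR t C)       s = app t (plug C s)
plug (orL C t)        s = plug C s ⊕ t
plug (orR t C)        s = t ⊕ plug C s
plug (letBody k env C) s = lett k env (plug C s)
plug (letBind k env i C b) s = lett k (env [ i ]≔ plug C s) b

_≤c_ : ∀ {n} → Tm n → Tm n → Set
_≤c_ {n} s t = ∀ {k} (C : Ctx k n) → ExCv≤ (plug C s) (plug C t)

_∼c_ : ∀ {n} → Tm n → Tm n → Set
s ∼c t = (s ≤c t) × (t ≤c s)

infix 4 _≤c_ _∼c_

-- A free variable has no evaluation, so it acts as a divergent term. With the
-- identity I, the term I ⊕ (x ⊕ x) converges after one probabilistic choice,
-- giving ExCv = 1/2, while (I ⊕ x) ⊕ x converges only along the choice
-- sequence left, left, giving ExCv = 1/4. Hence the empty context already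
-- refutes I ⊕ (x ⊕ x) ≤c (I ⊕ x) ⊕ x.
module Submission where

open import Defs
open import Data.Nat using (ℕ; suc)
open import Data.Fin using (Fin; zero)
open import Data.List using (List; []; _∷_)
open import Data.List.Relation.Unary.All using (All; []; _∷_)
open import Data.List.Relation.Unary.AllPairs using ([]; _∷_)
open import Data.List.Relation.Unary.Unique.Propositional using (Unique)
open import Data.Product using (Σ; ∃; ∃₂; _×_; _,_; proj₁)
open import Data.Sum using (_⊎_; inj₁; inj₂)
open import Data.Empty using (⊥; ⊥-elim)
open import Data.Unit using (tt)
open import Function using (case_of_)
open import Relation.Nullary using (¬_)
open import Relation.Nullary.Decidable using (toWitness; toWitnessFalse)
open import Relation.Binary.PropositionalEquality using (_≡_; refl; sym; trans; subst)
open import Data.Rational using (ℚ; 0ℚ) renaming (_+_ to _+ℚ_)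
open import Data.Rational.Properties using (_≤?_; _<?_)

unique-subsingleton : ∀ {a} {A : Set a} {P : A → Set} {x : A} →
                      (∀ {y} → P y → y ≡ x) →
                      ∀ {xs} → Unique xs → All P xs → xs ≡ [] ⊎ xs ≡ x ∷ []
unique-subsingleton only {[]}         _               _              = inj₁ refl
unique-subsingleton only {y ∷ []}     _               (py ∷ [])
  rewrite only py = inj₂ refl
unique-subsingleton only {y ∷ z ∷ _}  ((y≢z ∷ _) ∷ _) (py ∷ pz ∷ _) =
  ⊥-elim (y≢z (trans (only py) (sym (only pz))))

plugA-∷-app : ∀ {n} (a c : Tm n) cs → ∃₂ λ f u → plugA a (c ∷ cs) ≡ app f u
plugA-∷-app a c []       = a , c , refl
plugA-∷-app a c (d ∷ cs) = plugA-∷-app (app a c) d cs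

module _ {n : ℕ} where

  data ReducibleForm : Tm n → Set where
    app  : ∀ s t → ReducibleForm (app s t)
    _⊕_  : ∀ s t → ReducibleForm (s ⊕ t)
    lett : ∀ k env s → ReducibleForm (lett k env s)

  step-reducibleForm : ∀ {r} {s t : Tm n} → Step r s t → ReducibleForm s
  step-reducibleForm (rstep (inA [] (lbeta _ _)))      = app _ _
  step-reducibleForm (rstep (inA [] (probl _ _)))      = _ ⊕ _
  step-reducibleForm (rstep (inA [] (probr _ _)))      = _ ⊕ _
  step-reducibleForm (rstep (inA [] (lapp _ _ _ _)))   = app _ _
  step-reducibleForm (rstep (inA {a} (c ∷ cs) _)) with plugA-∷-app a c cs
  ... | f , u , eq = subst ReducibleForm (sym eq) (app f u)
  step-reducibleForm (rstep (inBody _ _ _ _))          = lett _ _ _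
  step-reducibleForm (rstep (inChain _ _ _ _ _ _ _ _ _)) = lett _ _ _
  step-reducibleForm (llet-in _ _ _ _ _)               = lett _ _ _
  step-reducibleForm (llet-e _ _ _ _ _ _ _ _ _ _)      = lett _ _ _
  step-reducibleForm (cp-in _ _ _ _ _ _ _ _)           = lett _ _ _
  step-reducibleForm (cp-e _ _ _ _ _ _ _ _ _ _ _ _ _ _) = lett _ _ _

  var-noEval : ∀ {i : Fin n} {τ} → ¬ IsEval (var i) τ
  var-noEval (done ())
  var-noEval (step st _) = case step-reducibleForm st of λ ()

  lam-eval⇒[] : ∀ {u : Tm (suc n)} {τ} → IsEval (lam u) τ → τ ≡ []
  lam-eval⇒[] (done _)    = refl
  lam-eval⇒[] (step st _) = case step-reducibleForm st of λ ()

  -- The equation s ≡ x ⊕ y is kept abstract so that Agda can refute the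
  -- cases whose source is a stuck plugA term.
  ⊕-step : ∀ {r} {s t x y : Tm n} → Step r s t → s ≡ x ⊕ y →
           (r ≡ probl × t ≡ x) ⊎ (r ≡ probr × t ≡ y)
  ⊕-step (rstep (inA [] (probl _ _))) refl = inj₁ (refl , refl)
  ⊕-step (rstep (inA [] (probr _ _))) refl = inj₂ (refl , refl)
  ⊕-step (rstep (inA [] (lbeta _ _)))      ()
  ⊕-step (rstep (inA [] (lapp _ _ _ _)))   ()
  ⊕-step (rstep (inA {a} (c ∷ cs) _)) eq with plugA-∷-app a c cs
  ... | _ , _ , eq′ with trans (sym eq) eq′
  ...   | ()
  ⊕-step (rstep (inBody _ _ _ _))          ()
  ⊕-step (rstep (inChain _ _ _ _ _ _ _ _ _)) ()
  ⊕-step (llet-in _ _ _ _ _)               ()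
  ⊕-step (llet-e _ _ _ _ _ _ _ _ _ _)      ()
  ⊕-step (cp-in _ _ _ _ _ _ _ _)           ()
  ⊕-step (cp-e _ _ _ _ _ _ _ _ _ _ _ _ _ _) ()

  ⊕-eval : ∀ {s t : Tm n} {τ} → IsEval (s ⊕ t) τ →
           (∃ λ τ′ → τ ≡ (probl , s) ∷ τ′ × IsEval s τ′) ⊎
           (∃ λ τ′ → τ ≡ (probr , t) ∷ τ′ × IsEval t τ′)
  ⊕-eval (done ())
  ⊕-eval (step st ev) with ⊕-step st refl
  ... | inj₁ (refl , refl) = inj₁ (_ , refl , ev)
  ... | inj₂ (refl , refl) = inj₂ (_ , refl , ev)

I : Tm 1
I = lam (var zero)

x : Tm 1
x = var zero

τ-left-left : Trace 1
τ-left-left = (probl , I ⊕ x) ∷ (probl , I) ∷ []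

eval-I⊕[x⊕x] : IsEval (I ⊕ (x ⊕ x)) ((probl , I) ∷ [])
eval-I⊕[x⊕x] = step (rstep (inA [] (probl _ _))) (done (lamW _))

eval-[I⊕x]⊕x : ∀ {τ} → IsEval ((I ⊕ x) ⊕ x) τ → τ ≡ τ-left-left
eval-[I⊕x]⊕x ev with ⊕-eval ev
... | inj₂ (_ , _ , ev-x) = ⊥-elim (var-noEval ev-x)
... | inj₁ (_ , refl , ev-I⊕x) with ⊕-eval ev-I⊕x
...   | inj₂ (_ , _ , ev-x) = ⊥-elim (var-noEval ev-x)
...   | inj₁ (_ , refl , ev-I) with lam-eval⇒[] ev-I
...     | refl = refl

¬ExCv≤ : ¬ ExCv≤ (I ⊕ (x ⊕ x)) ((I ⊕ x) ⊕ x)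
¬ExCv≤ ≤ with ≤ F ([] ∷ []) (eval-I⊕[x⊕x] ∷ []) ε (toWitness {a? = 0ℚ <? ε} tt)
  where
  F : List (Trace 1)
  F = ((probl , I) ∷ []) ∷ []
  ε : ℚ
  ε = halfPow 3
... | G , uniqueG , evalsG , F≤G+ε with unique-subsingleton eval-[I⊕x]⊕x uniqueG evalsG
...   | inj₁ refl = toWitnessFalse {a? = _ ≤? _} tt F≤G+ε
...   | inj₂ refl = toWitnessFalse {a? = _ ≤? _} tt F≤G+ε

proposition4p2 : Σ ℕ λ n → Σ (Tm n) λ r → Σ (Tm n) λ s → Σ (Tm n) λ t →
                   ¬ ((r ⊕ (s ⊕ t)) ∼c ((r ⊕ s) ⊕ t))
proposition4p2 = 1 , I , x , x , λ equiv → ¬ExCv≤ (proj₁ equiv hole)
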